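{- Let $p$ and $q$ be positive coprime integers with $p\geqslant 59\,q$ and $p>9q^3$, and let $$Q_{pq}(t)=t^{10}+(2q^2+p^2)(3q^2-2p^2)\,t^8+(q^8+10p^2q^6+4p^4q^4-14p^6q^2+p^8)\,t^6-p^2q^2(q^8-14p^2q^6+4p^4q^4+10p^6q^2+p^8)\,t^4-p^6q^6(q^2+2p^2)(3p^2-2q^2)\,t^2-q^{10}p^{10}.$$ Then there is no integer $t$ with $Q_{pq}(t)=0$ providing a perfect cuboid, i.e. no integer $t$ with $Q_{pq}(t)=0$, $t>p^2$, $t>pq$, $t>q^2$ and $(p^2+t)(pq+t)>2t^2$.
   Context: The equation $Q_{pq}(t)=0$ is the reduced cuboid characteristic equation arising in the case of the second cuboid conjecture. A triple of integers $p,q,t$ with $p\neq q$ positive and coprime and $Q_{pq}(t)=0$ is said to provide a perfect cuboid (a rectangular parallelepiped with integer edges, face diagonals and space diagonal) if and only if $t>p^2$, $t>pq$, $t>q^2$ and $(p^2+t)(pq+t)>2t^2$; this equivalence is taken from earlier work and is used here as the definition. -}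

module Defs where

open import Data.Integer using (ℤ; +_; _+_; _-_; _*_; _^_; -_; _<_; _≤_)
open import Data.Integer.Coprimality using (Coprime)
open import Data.Product using (_×_)
open import Relation.Binary.PropositionalEquality using (_≡_)

Q : ℤ → ℤ → ℤ → ℤ
Q p q t =
    t ^ 10
  + (+ 2 * q ^ 2 + p ^ 2) * (+ 3 * q ^ 2 - + 2 * p ^ 2) * t ^ 8
  + (q ^ 8 + + 10 * p ^ 2 * q ^ 6 + + 4 * p ^ 4 * q ^ 4 - + 14 * p ^ 6 * q ^ 2 + p ^ 8) * t ^ 6
  - p ^ 2 * q ^ 2 * (q ^ 8 - + 14 * p ^ 2 * q ^ 6 + + 4 * p ^ 4 * q ^ 4 + + 10 * p ^ 6 * q ^ 2 + p ^ 8) * t ^ 4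
  - p ^ 6 * q ^ 6 * (q ^ 2 + + 2 * p ^ 2) * (+ 3 * p ^ 2 - + 2 * q ^ 2) * t ^ 2
  - q ^ 10 * p ^ 10

ProvidesPerfectCuboid : ℤ → ℤ → ℤ → Set
ProvidesPerfectCuboid p q t =
  (Q p q t ≡ + 0) × (p ^ 2 < t) × (p * q < t) × (q ^ 2 < t)
  × (+ 2 * t ^ 2 < (p ^ 2 + t) * (p * q + t))

{-# OPTIONS --safe #-}
module Submission where

-- Write a = p - 59 q ≥ 0. Beyond t = p² + 2pq - 2q² the cuboid inequality fails:
-- 2t² - (p² + t)(pq + t) - 1 is a polynomial with nonnegative coefficients in a, q,
-- p - 9q³ - 1, q - 1 and t - (p² + 2pq - 2q²) - 1. On the remaining range
-- p² < t ≤ p² + 2pq - 2q², likewise -Q_{pq}(t) - 1 is a polynomial with nonnegative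
-- coefficients in a, q, p² + 2pq - 2q² - t, t - p² - 1 and q - 1, so Q_{pq}(t) < 0.

open import Defs
open import Data.Bool.Base using (T)
open import Data.Fin.Base using (Fin; zero; suc)
open import Data.Integer.Base
  using (ℤ; +_; 0ℤ; _+_; _-_; _*_; _^_; _<_; _≤_; +≤+; nonNegative)
  renaming (suc to sucℤ)
open import Data.Integer.Coprimality using (Coprime)
open import Data.Integer.Properties
  using (pos-*; +-mono-≤; i≤i+j; i≤j⇒0≤j-i; i<j⇒suc[i]≤j; suc[i]≤j⇒i<j;
         <⇒≤; ≮⇒≥; <-asym; <-irrefl)
open import Data.Integer.Solver using (module +-*-Solver)
open import Data.Maybe using (is-just; to-witness-T)
open import Data.Nat.Base using (ℕ; zero; suc; z≤n)
open import Data.Product.Base using (_,_)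
open import Data.Vec.Base using (Vec; []; _∷_; lookup)
open import Data.Vec.Relation.Unary.All using (All; []; _∷_)
open import Data.Vec.Relation.Unary.All.Properties using (lookup⁺)
open import Relation.Nullary using (¬_)
open import Relation.Binary.PropositionalEquality using (_≡_; subst)

open +-*-Solver
  using (Polynomial; ⟦_⟧; con; var; _:+_; _:*_; _:-_; _:^_; normalise; _≟N_; ⟦_⟧N-cong; prove)

private
  variable
    m n : ℕ
    i j k : ℤ

-- Unlike +-*-Solver.solve, this compares the normal forms themselves, as closed terms;
-- that stays feasible for the degree-20 identities below.
≡-by-normalisation : (e₁ e₂ : Polynomial n) → {T (is-just (normalise e₁ ≟N normalise e₂))} →
                     ∀ ρ → ⟦ e₁ ⟧ ρ ≡ ⟦ e₂ ⟧ ρ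
≡-by-normalisation e₁ e₂ {same-normal-form} ρ =
  prove ρ e₁ e₂ (⟦ to-witness-T (normalise e₁ ≟N normalise e₂) same-normal-form ⟧N-cong ρ)

infixl 6 _⊕_
infixl 7 _⊗_
infixr 8 _⊛_

data Polynomial⁺ (n : ℕ) : Set where
  var : Fin n → Polynomial⁺ n
  con : ℕ → Polynomial⁺ n
  _⊕_ _⊗_ : Polynomial⁺ n → Polynomial⁺ n → Polynomial⁺ n

_⊛_ : Polynomial⁺ n → ℕ → Polynomial⁺ n
e ⊛ zero  = con 1
e ⊛ suc k = e ⊗ e ⊛ k

geometricSum : Polynomial⁺ n → ℕ → Polynomial⁺ n
geometricSum x zero    = con 0
geometricSum x (suc k) = con 1 ⊕ x ⊗ geometricSum x k

instantiate : Polynomial⁺ m → Vec (Polynomial n) m → Polynomial n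
instantiate (var x) σ = lookup σ x
instantiate (con c) σ = con (+ c)
instantiate (e ⊕ f) σ = instantiate e σ :+ instantiate f σ
instantiate (e ⊗ f) σ = instantiate e σ :* instantiate f σ

0≤i⇒0≤j⇒0≤i*j : 0ℤ ≤ i → 0ℤ ≤ j → 0ℤ ≤ i * j
0≤i⇒0≤j⇒0≤i*j {+ m} {+ n} _ _ = subst (0ℤ ≤_) (pos-* m n) (+≤+ z≤n)

instantiate-nonNegative : (e : Polynomial⁺ m) (σ : Vec (Polynomial n) m) (ρ : Vec ℤ n) →
                          All (λ s → 0ℤ ≤ ⟦ s ⟧ ρ) σ → 0ℤ ≤ ⟦ instantiate e σ ⟧ ρ
instantiate-nonNegative (var x) σ ρ 0≤σ = lookup⁺ 0≤σ x
instantiate-nonNegative (con c) σ ρ 0≤σ = +≤+ z≤n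
instantiate-nonNegative (e ⊕ f) σ ρ 0≤σ =
  +-mono-≤ (instantiate-nonNegative e σ ρ 0≤σ) (instantiate-nonNegative f σ ρ 0≤σ)
instantiate-nonNegative (e ⊗ f) σ ρ 0≤σ =
  0≤i⇒0≤j⇒0≤i*j (instantiate-nonNegative e σ ρ 0≤σ) (instantiate-nonNegative f σ ρ 0≤σ)

suc[i]+j≡k⇒i<k : 0ℤ ≤ j → sucℤ i + j ≡ k → i < k
suc[i]+j≡k⇒i<k {j = j} {i = i} 0≤j eq =
  suc[i]≤j⇒i<j (subst (sucℤ i ≤_) eq (i≤i+j (sucℤ i) j {{nonNegative 0≤j}}))

i<j⇒0≤j-suc[i] : i < j → 0ℤ ≤ j - sucℤ i
i<j⇒0≤j-suc[i] i<j = i≤j⇒0≤j-i (i<j⇒suc[i]≤j i<j)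

cuboidBound : ℤ → ℤ → ℤ
cuboidBound p q = p ^ 2 + + 2 * p * q - + 2 * q ^ 2

p̂ q̂ t̂ cuboidBound̂ Q̂ : Polynomial 3
p̂ = var zero
q̂ = var (suc zero)
t̂ = var (suc (suc zero))
cuboidBound̂ = p̂ :^ 2 :+ con (+ 2) :* p̂ :* q̂ :- con (+ 2) :* q̂ :^ 2
Q̂ = t̂ :^ 10
  :+ (con (+ 2) :* q̂ :^ 2 :+ p̂ :^ 2) :* (con (+ 3) :* q̂ :^ 2 :- con (+ 2) :* p̂ :^ 2) :* t̂ :^ 8
  :+ (q̂ :^ 8 :+ con (+ 10) :* p̂ :^ 2 :* q̂ :^ 6 :+ con (+ 4) :* p̂ :^ 4 :* q̂ :^ 4
      :- con (+ 14) :* p̂ :^ 6 :* q̂ :^ 2 :+ p̂ :^ 8) :* t̂ :^ 6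
  :- p̂ :^ 2 :* q̂ :^ 2 :* (q̂ :^ 8 :- con (+ 14) :* p̂ :^ 2 :* q̂ :^ 6 :+ con (+ 4) :* p̂ :^ 4 :* q̂ :^ 4
      :+ con (+ 10) :* p̂ :^ 6 :* q̂ :^ 2 :+ p̂ :^ 8) :* t̂ :^ 4
  :- p̂ :^ 6 :* q̂ :^ 6 :* (q̂ :^ 2 :+ con (+ 2) :* p̂ :^ 2) :* (con (+ 3) :* p̂ :^ 2 :- con (+ 2) :* q̂ :^ 2) :* t̂ :^ 2
  :- q̂ :^ 10 :* p̂ :^ 10

cuboid-certificate : Polynomial⁺ 5
cuboid-certificate =
  p ⊗ (b ⊕ con 1 ⊕ con 3 ⊗ q ⊛ 3) ⊕ con 3 ⊗ p ⊗ q ⊕ con 4 ⊗ q ⊛ 2 ⊗ q₀ ⊗ (q ⊕ con 1)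
  ⊕ e ⊗ (p ⊗ (a ⊕ con 58 ⊗ q) ⊕ con 4 ⊗ q ⊗ (a ⊕ con 58 ⊗ q) ⊕ con 2 ⊕ e)
  where
  a q b q₀ e p : Polynomial⁺ 5
  a  = var zero
  q  = var (suc zero)
  b  = var (suc (suc zero))
  q₀ = var (suc (suc (suc zero)))
  e  = var (suc (suc (suc (suc zero))))
  p  = a ⊕ con 59 ⊗ q

cuboid-substitution : Vec (Polynomial 3) 5
cuboid-substitution =
  p̂ :- con (+ 59) :* q̂ ∷ q̂ ∷ p̂ :- (con (+ 1) :+ con (+ 9) :* q̂ :^ 3) ∷ q̂ :- con (+ 1)
  ∷ t̂ :- (con (+ 1) :+ cuboidBound̂) ∷ []

cuboid-certificate-identity : ∀ p q t →
  sucℤ ((p ^ 2 + t) * (p * q + t)) + ⟦ instantiate cuboid-certificate cuboid-substitution ⟧ (p ∷ q ∷ t ∷ [])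
    ≡ + 2 * t ^ 2
cuboid-certificate-identity p q t =
  ≡-by-normalisation
    (con (+ 1) :+ (p̂ :^ 2 :+ t̂) :* (p̂ :* q̂ :+ t̂) :+ instantiate cuboid-certificate cuboid-substitution)
    (con (+ 2) :* t̂ :^ 2)
    (p ∷ q ∷ t ∷ [])

-- -Q_{pq}(t) = c q²⁰ + (terms with nonnegative coefficients), c = 2030482921171167586501503520000;
-- the constant 1 is split off through c q²⁰ = c + c (q - 1)(1 + q + ⋯ + q¹⁹).
Q-certificate : Polynomial⁺ 5
Q-certificate =
  con 2030482921171167586501503519999 ⊕ con 2030482921171167586501503520000 ⊗ q₀ ⊗ geometricSum q 20
  ⊕ r ⊛ 9 ⊗ w
  ⊕ con 138 ⊗ q ⊛ 2 ⊗ r ⊛ 8 ⊗ w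
  ⊕ con 35990 ⊗ q ⊛ 2 ⊗ r ⊛ 9
  ⊕ con 558031213 ⊗ q ⊛ 4 ⊗ r ⊛ 7 ⊗ w
  ⊕ con 24721 ⊗ q ⊛ 4 ⊗ r ⊛ 8
  ⊕ con 66250087790 ⊗ q ⊛ 6 ⊗ r ⊛ 6 ⊗ w
  ⊕ con 4887658908544 ⊗ q ⊛ 6 ⊗ r ⊛ 7
  ⊕ con 26529968522146352 ⊗ q ⊛ 8 ⊗ r ⊛ 5 ⊗ w
  ⊕ con 2305062220564 ⊗ q ⊛ 8 ⊗ r ⊛ 6
  ⊕ con 3131755490494727958 ⊗ q ⊛ 10 ⊗ r ⊛ 4 ⊗ w
  ⊕ con 91728474191841863014 ⊗ q ⊛ 10 ⊗ r ⊛ 5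
  ⊕ con 199571466417213516804673 ⊗ q ⊛ 12 ⊗ r ⊛ 3 ⊗ w
  ⊕ con 4631407505438976861 ⊗ q ⊛ 12 ⊗ r ⊛ 4
  ⊕ con 23556863534309022232888714 ⊗ q ⊛ 14 ⊗ r ⊛ 2 ⊗ w
  ⊕ con 253699803378052422179968980 ⊗ q ⊛ 14 ⊗ r ⊛ 3
  ⊕ con 161071745596519995904287410416 ⊗ q ⊛ 16 ⊗ r ⊗ w
  ⊕ con 1801642495981172330048964 ⊗ q ⊛ 16 ⊗ r ⊛ 2
  ⊕ con 6570254281024537663463510342912 ⊗ q ⊛ 18 ⊗ r
  ⊕ con 2 ⊗ a ⊗ q ⊗ r ⊛ 8 ⊗ w
  ⊕ con 1200 ⊗ a ⊗ q ⊗ r ⊛ 9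
  ⊕ con 37205440 ⊗ a ⊗ q ⊛ 3 ⊗ r ⊛ 7 ⊗ w
  ⊕ con 478 ⊗ a ⊗ q ⊛ 3 ⊗ r ⊛ 8
  ⊕ con 5526684362 ⊗ a ⊗ q ⊛ 5 ⊗ r ⊛ 6 ⊗ w
  ⊕ con 488407695296 ⊗ a ⊗ q ⊛ 5 ⊗ r ⊛ 7
  ⊕ con 3530849283027192 ⊗ a ⊗ q ⊛ 7 ⊗ r ⊛ 5 ⊗ w
  ⊕ con 192918260096 ⊗ a ⊗ q ⊛ 7 ⊗ r ⊛ 6
  ⊕ con 469823996018851460 ⊗ a ⊗ q ⊛ 9 ⊗ r ⊛ 4 ⊗ w
  ⊕ con 15240404224277285620 ⊗ a ⊗ q ⊛ 9 ⊗ r ⊛ 5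
  ⊕ con 39696132067877141318972 ⊗ a ⊗ q ⊛ 11 ⊗ r ⊛ 3 ⊗ w
  ⊕ con 625517216601401256 ⊗ a ⊗ q ⊛ 11 ⊗ r ⊛ 4
  ⊕ con 5084535165535057838429226 ⊗ a ⊗ q ⊛ 13 ⊗ r ⊛ 2 ⊗ w
  ⊕ con 58682725474697962654059584 ⊗ a ⊗ q ⊛ 13 ⊗ r ⊛ 3
  ⊕ con 42161785639059483197313943088 ⊗ a ⊗ q ⊛ 15 ⊗ r ⊗ w
  ⊕ con 345729044807278296638912 ⊗ a ⊗ q ⊛ 15 ⊗ r ⊛ 2
  ⊕ con 1977018531431309771189590438784 ⊗ a ⊗ q ⊛ 17 ⊗ r
  ⊕ con 545234579904735860600126636000 ⊗ a ⊗ q ⊛ 19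
  ⊕ con 10 ⊗ a ⊛ 2 ⊗ r ⊛ 9
  ⊕ con 929962 ⊗ a ⊛ 2 ⊗ q ⊛ 2 ⊗ r ⊛ 7 ⊗ w
  ⊕ a ⊛ 2 ⊗ q ⊛ 2 ⊗ r ⊛ 8
  ⊕ con 184490444 ⊗ a ⊛ 2 ⊗ q ⊛ 4 ⊗ r ⊛ 6 ⊗ w
  ⊕ con 20331629864 ⊗ a ⊛ 2 ⊗ q ⊛ 4 ⊗ r ⊛ 7
  ⊕ con 205558947027620 ⊗ a ⊛ 2 ⊗ q ⊛ 6 ⊗ r ⊛ 5 ⊗ w
  ⊕ con 6457366392 ⊗ a ⊛ 2 ⊗ q ⊛ 6 ⊗ r ⊛ 6
  ⊕ con 31322895851511042 ⊗ a ⊛ 2 ⊗ q ⊛ 8 ⊗ r ⊛ 4 ⊗ w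
  ⊕ con 1139291003183561626 ⊗ a ⊛ 2 ⊗ q ⊛ 8 ⊗ r ⊛ 5
  ⊕ con 3618401496600948166650 ⊗ a ⊛ 2 ⊗ q ⊛ 10 ⊗ r ⊛ 3 ⊗ w
  ⊕ con 36960417575311486 ⊗ a ⊛ 2 ⊗ q ⊛ 10 ⊗ r ⊛ 4
  ⊕ con 506458056162873060170040 ⊗ a ⊛ 2 ⊗ q ⊛ 12 ⊗ r ⊛ 2 ⊗ w
  ⊕ con 6300639951282942092598756 ⊗ a ⊛ 2 ⊗ q ⊛ 12 ⊗ r ⊛ 3
  ⊕ con 5171136565889946741284393640 ⊗ a ⊛ 2 ⊗ q ⊛ 14 ⊗ r ⊗ w
  ⊕ con 30303825057345017016644 ⊗ a ⊛ 2 ⊗ q ⊛ 14 ⊗ r ⊛ 2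
  ⊕ con 279013177147006731228007975184 ⊗ a ⊛ 2 ⊗ q ⊛ 16 ⊗ r
  ⊕ con 68626106986582934582445284400 ⊗ a ⊛ 2 ⊗ q ⊛ 18
  ⊕ con 10328 ⊗ a ⊛ 3 ⊗ q ⊗ r ⊛ 7 ⊗ w
  ⊕ con 3080564 ⊗ a ⊛ 3 ⊗ q ⊛ 3 ⊗ r ⊛ 6 ⊗ w
  ⊕ con 451313184 ⊗ a ⊛ 3 ⊗ q ⊛ 3 ⊗ r ⊛ 7
  ⊕ con 6837405077376 ⊗ a ⊛ 3 ⊗ q ⊛ 5 ⊗ r ⊛ 5 ⊗ w
  ⊕ con 108053072 ⊗ a ⊛ 3 ⊗ q ⊛ 5 ⊗ r ⊛ 6
  ⊕ con 1218050008761968 ⊗ a ⊛ 3 ⊗ q ⊛ 7 ⊗ r ⊛ 4 ⊗ w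
  ⊕ con 50461687740226120 ⊗ a ⊛ 3 ⊗ q ⊛ 7 ⊗ r ⊛ 5
  ⊕ con 199865569912026658188 ⊗ a ⊛ 3 ⊗ q ⊛ 9 ⊗ r ⊛ 3 ⊗ w
  ⊕ con 1247928276641576 ⊗ a ⊛ 3 ⊗ q ⊛ 9 ⊗ r ⊛ 4
  ⊕ con 30825170522744685702300 ⊗ a ⊛ 3 ⊗ q ⊛ 11 ⊗ r ⊛ 2 ⊗ w
  ⊕ con 416200438819606641405024 ⊗ a ⊛ 3 ⊗ q ⊛ 11 ⊗ r ⊛ 3
  ⊕ con 394473763850500388936521728 ⊗ a ⊛ 3 ⊗ q ⊛ 13 ⊗ r ⊗ w
  ⊕ con 1603604748878172089832 ⊗ a ⊛ 3 ⊗ q ⊛ 13 ⊗ r ⊛ 2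
  ⊕ con 24536715036239664351431446448 ⊗ a ⊛ 3 ⊗ q ⊛ 15 ⊗ r
  ⊕ con 5374294607234820178948108800 ⊗ a ⊛ 3 ⊗ q ⊛ 17
  ⊕ con 43 ⊗ a ⊛ 4 ⊗ r ⊛ 7 ⊗ w
  ⊕ con 25730 ⊗ a ⊛ 4 ⊗ q ⊛ 2 ⊗ r ⊛ 6 ⊗ w
  ⊕ con 5634064 ⊗ a ⊛ 4 ⊗ q ⊛ 2 ⊗ r ⊛ 7
  ⊕ con 142121927328 ⊗ a ⊛ 4 ⊗ q ⊛ 4 ⊗ r ⊛ 5 ⊗ w
  ⊕ con 903892 ⊗ a ⊛ 4 ⊗ q ⊛ 4 ⊗ r ⊛ 6
  ⊕ con 30446699846896 ⊗ a ⊛ 4 ⊗ q ⊛ 6 ⊗ r ⊛ 4 ⊗ w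
  ⊕ con 1466527656754816 ⊗ a ⊛ 4 ⊗ q ⊛ 6 ⊗ r ⊛ 5
  ⊕ con 7450730253591731999 ⊗ a ⊛ 4 ⊗ q ⊛ 8 ⊗ r ⊛ 3 ⊗ w
  ⊕ con 26333921478071 ⊗ a ⊛ 4 ⊗ q ⊛ 8 ⊗ r ⊛ 4
  ⊕ con 1279041684205119984454 ⊗ a ⊛ 4 ⊗ q ⊛ 10 ⊗ r ⊛ 2 ⊗ w
  ⊕ con 18896780367393491533476 ⊗ a ⊛ 4 ⊗ q ⊛ 10 ⊗ r ⊛ 3
  ⊕ con 20947851861683841300782328 ⊗ a ⊛ 4 ⊗ q ⊛ 12 ⊗ r ⊗ w
  ⊕ con 57028688153079241852 ⊗ a ⊛ 4 ⊗ q ⊛ 12 ⊗ r ⊛ 2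
  ⊕ con 1506378331190940789882729776 ⊗ a ⊛ 4 ⊗ q ⊛ 14 ⊗ r
  ⊕ con 293096582154651489401758032 ⊗ a ⊛ 4 ⊗ q ⊛ 16
  ⊕ con 86 ⊗ a ⊛ 5 ⊗ q ⊗ r ⊛ 6 ⊗ w
  ⊕ con 37504 ⊗ a ⊛ 5 ⊗ q ⊗ r ⊛ 7
  ⊕ con 1890360956 ⊗ a ⊛ 5 ⊗ q ⊛ 3 ⊗ r ⊛ 5 ⊗ w
  ⊕ con 3024 ⊗ a ⊛ 5 ⊗ q ⊛ 3 ⊗ r ⊛ 6
  ⊕ con 507316620504 ⊗ a ⊛ 5 ⊗ q ⊛ 5 ⊗ r ⊛ 4 ⊗ w
  ⊕ con 29220885931720 ⊗ a ⊛ 5 ⊗ q ⊛ 5 ⊗ r ⊛ 5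
  ⊕ con 197484149020932200 ⊗ a ⊛ 5 ⊗ q ⊛ 7 ⊗ r ⊛ 3 ⊗ w
  ⊕ con 355643187760 ⊗ a ⊛ 5 ⊗ q ⊛ 7 ⊗ r ⊛ 4
  ⊕ con 38207097369871930094 ⊗ a ⊛ 5 ⊗ q ⊛ 9 ⊗ r ⊛ 2 ⊗ w
  ⊕ con 623825164370285143360 ⊗ a ⊛ 5 ⊗ q ⊛ 9 ⊗ r ⊛ 3
  ⊕ con 821096249089654474743296 ⊗ a ⊛ 5 ⊗ q ⊛ 11 ⊗ r ⊗ w
  ⊕ con 1434956318600830464 ⊗ a ⊛ 5 ⊗ q ⊛ 11 ⊗ r ⊛ 2
  ⊕ con 68532464957072339223750352 ⊗ a ⊛ 5 ⊗ q ⊛ 13 ⊗ r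
  ⊕ con 11803437262989669103745792 ⊗ a ⊛ 5 ⊗ q ⊛ 15
  ⊕ con 104 ⊗ a ⊛ 6 ⊗ r ⊛ 7
  ⊕ con 15712358 ⊗ a ⊛ 6 ⊗ q ⊛ 2 ⊗ r ⊛ 5 ⊗ w
  ⊕ con 5634808860 ⊗ a ⊛ 6 ⊗ q ⊛ 4 ⊗ r ⊛ 4 ⊗ w
  ⊕ con 404263779612 ⊗ a ⊛ 6 ⊗ q ⊛ 4 ⊗ r ⊛ 5
  ⊕ con 3816161705515844 ⊗ a ⊛ 6 ⊗ q ⊛ 6 ⊗ r ⊛ 3 ⊗ w
  ⊕ con 3001832680 ⊗ a ⊛ 6 ⊗ q ⊛ 6 ⊗ r ⊛ 4
  ⊕ con 845310476842001068 ⊗ a ⊛ 6 ⊗ q ⊛ 8 ⊗ r ⊛ 2 ⊗ w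
  ⊕ con 15441497728178077860 ⊗ a ⊛ 6 ⊗ q ⊛ 8 ⊗ r ⊛ 3
  ⊕ con 24574027180749455605024 ⊗ a ⊛ 6 ⊗ q ⊛ 10 ⊗ r ⊗ w
  ⊕ con 26174300239184156 ⊗ a ⊛ 6 ⊗ q ⊛ 10 ⊗ r ⊛ 2
  ⊕ con 2393044621021313063901856 ⊗ a ⊛ 6 ⊗ q ⊛ 12 ⊗ r
  ⊕ con 363092257268693415696896 ⊗ a ⊛ 6 ⊗ q ⊛ 14
  ⊕ con 74616 ⊗ a ⊛ 7 ⊗ q ⊗ r ⊛ 5 ⊗ w
  ⊕ con 40229404 ⊗ a ⊛ 7 ⊗ q ⊛ 3 ⊗ r ⊛ 4 ⊗ w
  ⊕ con 3834508520 ⊗ a ⊛ 7 ⊗ q ⊛ 3 ⊗ r ⊛ 5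
  ⊕ con 54170303091112 ⊗ a ⊛ 7 ⊗ q ⊛ 5 ⊗ r ⊛ 3 ⊗ w
  ⊕ con 14478160 ⊗ a ⊛ 7 ⊗ q ⊛ 5 ⊗ r ⊛ 4
  ⊕ con 14024756043236408 ⊗ a ⊛ 7 ⊗ q ⊛ 7 ⊗ r ⊛ 2 ⊗ w
  ⊕ con 291141728986098208 ⊗ a ⊛ 7 ⊗ q ⊛ 7 ⊗ r ⊛ 3
  ⊕ con 572806955602405203712 ⊗ a ⊛ 7 ⊗ q ⊛ 9 ⊗ r ⊗ w
  ⊕ con 348373166300312 ⊗ a ⊛ 7 ⊗ q ⊛ 9 ⊗ r ⊛ 2
  ⊕ con 65522269533718072359488 ⊗ a ⊛ 7 ⊗ q ⊛ 11 ⊗ r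
  ⊕ con 8702951078904435735744 ⊗ a ⊛ 7 ⊗ q ⊛ 13
  ⊕ con 155 ⊗ a ⊛ 8 ⊗ r ⊛ 5 ⊗ w
  ⊕ con 167522 ⊗ a ⊛ 8 ⊗ q ⊛ 2 ⊗ r ⊛ 4 ⊗ w
  ⊕ con 23864566 ⊗ a ⊛ 8 ⊗ q ⊛ 2 ⊗ r ⊛ 5
  ⊕ con 560602913854 ⊗ a ⊛ 8 ⊗ q ⊛ 4 ⊗ r ⊛ 3 ⊗ w
  ⊕ con 30550 ⊗ a ⊛ 8 ⊗ q ⊛ 4 ⊗ r ⊛ 4
  ⊕ con 174493871672100 ⊗ a ⊛ 8 ⊗ q ⊛ 6 ⊗ r ⊛ 2 ⊗ w
  ⊕ con 4201660377087128 ⊗ a ⊛ 8 ⊗ q ⊛ 6 ⊗ r ⊛ 3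
  ⊕ con 10509233598231938600 ⊗ a ⊛ 8 ⊗ q ⊛ 8 ⊗ r ⊗ w
  ⊕ con 3353562260880 ⊗ a ⊛ 8 ⊗ q ⊛ 8 ⊗ r ⊛ 2
  ⊕ con 1424408373202411016016 ⊗ a ⊛ 8 ⊗ q ⊛ 10 ⊗ r
  ⊕ con 164265809036906374384 ⊗ a ⊛ 8 ⊗ q ⊛ 12
  ⊕ con 310 ⊗ a ⊛ 9 ⊗ q ⊗ r ⊛ 4 ⊗ w
  ⊕ con 88000 ⊗ a ⊛ 9 ⊗ q ⊗ r ⊛ 5
  ⊕ con 4124952154 ⊗ a ⊛ 9 ⊗ q ⊛ 3 ⊗ r ⊛ 3 ⊗ w
  ⊕ con 1607958099784 ⊗ a ⊛ 9 ⊗ q ⊛ 5 ⊗ r ⊛ 2 ⊗ w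
  ⊕ con 46187122813304 ⊗ a ⊛ 9 ⊗ q ⊛ 5 ⊗ r ⊛ 3
  ⊕ con 152264791319258048 ⊗ a ⊛ 9 ⊗ q ⊛ 7 ⊗ r ⊗ w
  ⊕ con 22731774880 ⊗ a ⊛ 9 ⊗ q ⊛ 7 ⊗ r ⊛ 2
  ⊕ con 24730130563969039600 ⊗ a ⊛ 9 ⊗ q ⊛ 9 ⊗ r
  ⊕ con 2449645645442672512 ⊗ a ⊛ 9 ⊗ q ⊛ 11
  ⊕ con 146 ⊗ a ⊛ 10 ⊗ r ⊛ 5
  ⊕ con 20484129 ⊗ a ⊛ 10 ⊗ q ⊛ 2 ⊗ r ⊛ 3 ⊗ w
  ⊕ con 10667044826 ⊗ a ⊛ 10 ⊗ q ⊛ 4 ⊗ r ⊛ 2 ⊗ w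
  ⊕ con 380681933676 ⊗ a ⊛ 10 ⊗ q ⊛ 4 ⊗ r ⊛ 3
  ⊕ con 1736357025862592 ⊗ a ⊛ 10 ⊗ q ⊛ 6 ⊗ r ⊗ w
  ⊕ con 102753472 ⊗ a ⊛ 10 ⊗ q ⊛ 6 ⊗ r ⊛ 2
  ⊕ con 342942571887079872 ⊗ a ⊛ 10 ⊗ q ⊛ 8 ⊗ r
  ⊕ con 28766723410771968 ⊗ a ⊛ 10 ⊗ q ⊛ 10
  ⊕ con 61640 ⊗ a ⊛ 11 ⊗ q ⊗ r ⊛ 3 ⊗ w
  ⊕ con 48241778 ⊗ a ⊛ 11 ⊗ q ⊛ 3 ⊗ r ⊛ 2 ⊗ w
  ⊕ con 2281278440 ⊗ a ⊛ 11 ⊗ q ⊛ 3 ⊗ r ⊛ 3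
  ⊕ con 15420152788552 ⊗ a ⊛ 11 ⊗ q ⊛ 5 ⊗ r ⊗ w
  ⊕ con 277216 ⊗ a ⊛ 11 ⊗ q ⊛ 5 ⊗ r ⊛ 2
  ⊕ con 3777420536222784 ⊗ a ⊛ 11 ⊗ q ⊛ 7 ⊗ r
  ⊕ con 263219777131296 ⊗ a ⊛ 11 ⊗ q ⊛ 9
  ⊕ con 85 ⊗ a ⊛ 12 ⊗ r ⊛ 3 ⊗ w
  ⊕ con 133310 ⊗ a ⊛ 12 ⊗ q ⊛ 2 ⊗ r ⊛ 2 ⊗ w
  ⊕ con 9395968 ⊗ a ⊛ 12 ⊗ q ⊛ 2 ⊗ r ⊛ 3
  ⊕ con 104545740684 ⊗ a ⊛ 12 ⊗ q ⊛ 4 ⊗ r ⊗ w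
  ⊕ con 336 ⊗ a ⊛ 12 ⊗ q ⊛ 4 ⊗ r ⊛ 2
  ⊕ con 32646944867960 ⊗ a ⊛ 12 ⊗ q ⊛ 6 ⊗ r
  ⊕ con 1839743487200 ⊗ a ⊛ 12 ⊗ q ⊛ 8
  ⊕ con 170 ⊗ a ⊛ 13 ⊗ q ⊗ r ⊛ 2 ⊗ w
  ⊕ con 23808 ⊗ a ⊛ 13 ⊗ q ⊗ r ⊛ 3
  ⊕ con 523090768 ⊗ a ⊛ 13 ⊗ q ⊛ 3 ⊗ r ⊗ w
  ⊕ con 216768116632 ⊗ a ⊛ 13 ⊗ q ⊛ 5 ⊗ r
  ⊕ con 9495204864 ⊗ a ⊛ 13 ⊗ q ⊛ 7
  ⊕ con 28 ⊗ a ⊛ 14 ⊗ r ⊛ 3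
  ⊕ con 1821528 ⊗ a ⊛ 14 ⊗ q ⊛ 2 ⊗ r ⊗ w
  ⊕ con 1067920464 ⊗ a ⊛ 14 ⊗ q ⊛ 4 ⊗ r
  ⊕ con 34127808 ⊗ a ⊛ 14 ⊗ q ⊛ 6
  ⊕ con 3944 ⊗ a ⊛ 15 ⊗ q ⊗ r ⊗ w
  ⊕ con 3678736 ⊗ a ⊛ 15 ⊗ q ⊛ 3 ⊗ r
  ⊕ con 76320 ⊗ a ⊛ 15 ⊗ q ⊛ 5
  ⊕ con 4 ⊗ a ⊛ 16 ⊗ r ⊗ w
  ⊕ con 7912 ⊗ a ⊛ 16 ⊗ q ⊛ 2 ⊗ r
  ⊕ con 80 ⊗ a ⊛ 16 ⊗ q ⊛ 4
  ⊕ con 8 ⊗ a ⊛ 17 ⊗ q ⊗ r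
  where
  a q r u q₀ w : Polynomial⁺ 5
  a  = var zero
  q  = var (suc zero)
  r  = var (suc (suc zero))
  u  = var (suc (suc (suc zero)))
  q₀ = var (suc (suc (suc (suc zero))))
  w  = u ⊕ con 1 ⊕ con 2 ⊗ q ⊛ 2   -- t - p² + 2q²

Q-substitution : Vec (Polynomial 3) 5
Q-substitution =
  p̂ :- con (+ 59) :* q̂ ∷ q̂ ∷ cuboidBound̂ :- t̂ ∷ t̂ :- (con (+ 1) :+ p̂ :^ 2) ∷ q̂ :- con (+ 1) ∷ []

-- In this shape the certificate is never unfolded during type checking:
-- Data.Integer._+_ inspects its second argument only once the first is a constructor.
Q-certificate-identity : ∀ p q t →
  sucℤ (Q p q t) + ⟦ instantiate Q-certificate Q-substitution ⟧ (p ∷ q ∷ t ∷ []) ≡ 0ℤ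
Q-certificate-identity p q t =
  ≡-by-normalisation (con (+ 1) :+ Q̂ :+ instantiate Q-certificate Q-substitution) (con 0ℤ) (p ∷ q ∷ t ∷ [])

cuboidBound<t⇒[p²+t][pq+t]<2t² : ∀ {p q t} → 0ℤ < q → + 59 * q ≤ p → + 9 * q ^ 3 < p →
                                   cuboidBound p q < t → (p ^ 2 + t) * (p * q + t) < + 2 * t ^ 2
cuboidBound<t⇒[p²+t][pq+t]<2t² {p} {q} {t} 0<q 59q≤p 9q³<p bound<t =
  suc[i]+j≡k⇒i<k
    (instantiate-nonNegative cuboid-certificate cuboid-substitution (p ∷ q ∷ t ∷ [])
      (i≤j⇒0≤j-i 59q≤p ∷ <⇒≤ 0<q ∷ i<j⇒0≤j-suc[i] 9q³<p ∷ i<j⇒0≤j-suc[i] 0<q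
        ∷ i<j⇒0≤j-suc[i] bound<t ∷ []))
    (cuboid-certificate-identity p q t)

p²<t≤cuboidBound⇒Q<0 : ∀ {p q t} → 0ℤ < q → + 59 * q ≤ p → p ^ 2 < t → t ≤ cuboidBound p q →
                       Q p q t < 0ℤ
p²<t≤cuboidBound⇒Q<0 {p} {q} {t} 0<q 59q≤p p²<t t≤bound =
  suc[i]+j≡k⇒i<k
    (instantiate-nonNegative Q-certificate Q-substitution (p ∷ q ∷ t ∷ [])
      (i≤j⇒0≤j-i 59q≤p ∷ <⇒≤ 0<q ∷ i≤j⇒0≤j-i t≤bound ∷ i<j⇒0≤j-suc[i] p²<t ∷ i<j⇒0≤j-suc[i] 0<q ∷ []))
    (Q-certificate-identity p q t)

theorem8p5 : (p q : ℤ) → + 0 < p → + 0 < q → Coprime p q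
           → + 59 * q ≤ p → + 9 * q ^ 3 < p
           → (t : ℤ) → ¬ ProvidesPerfectCuboid p q t
theorem8p5 p q _ 0<q _ 59q≤p 9q³<p t (Q≡0 , p²<t , _ , _ , cuboid) =
  <-irrefl Q≡0 (p²<t≤cuboidBound⇒Q<0 0<q 59q≤p p²<t t≤bound)
  where
  t≤bound : t ≤ cuboidBound p q
  t≤bound = ≮⇒≥ λ bound<t → <-asym cuboid (cuboidBound<t⇒[p²+t][pq+t]<2t² 0<q 59q≤p 9q³<p bound<t)
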